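{- Let $x$ be a variable and $\beta$ a Boolean combination of $x$-separated atomic formulas. Then there exists a Boolean combination $\gamma$ of $x$-free atomic formulas such that the triple $(\beta,\gamma,1)$ satisfies Condition $(\ast)$ and $\exists x\colon\beta$ is equivalent to $\gamma$.
   Context: Integers with $+$, $<$, and $\equiv_k$ ($m\equiv_k n$ iff $k\mid m-n$). Terms are built from variables and integer constants by addition and multiplication by integers; each has a unique normal form $a_1x_{i_1}+\dots+a_nx_{i_n}+c$ with $i_1<\dots<i_n$, $a_j\neq0$ (coefficients $a_j$, constant $c$). A term is $x$-free if its normal form does not contain $x$; an atomic formula ($s<t$ or $s\equiv_k t$, $k\ge1$) is $x$-free if its terms are $x$-free. An atomic formula is $x$-separated if it has the form $ax<t$, $t<ax$ or $ax\equiv_k t$ with $a\in\mathbb{N}$ and $t$ an $x$-free term. A Boolean combination uses only $\neg,\land,\lor,\to,\leftrightarrow$. Equivalence means same truth value under every assignment of integers to variables. $\textsc{Coeff}(\varphi)$: $0,\pm1,\pm2$ and $\pm a$ for $a$ a coefficient of the normal form of $s_1-s_2$ for an atomic subformula $s_1<s_2$ of $\varphi$; $\textsc{Const}(\varphi)$: $0,\pm1,\pm2$ and $\pm c$ for $c$ the constant of such $s_1-s_2$; $\textsc{Mod}(\varphi)$: $1$ and all $k$ such that an atomic subformula $s_1\equiv_k s_2$ occurs in $\varphi$. For $p\ge1$: $\textsc{Coeff}_p(\beta)=\{a_1a_2-a_3a_4 : a_i\in\textsc{Coeff}(\beta)\}$; $\textsc{Const}_p(\beta)=\{a_1c_1-a_2(c_2+c):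 a_1,a_2\in\textsc{Coeff}(\beta),\ c_1,c_2\in\textsc{Const}(\beta),\ c\in\mathbb{Z},\ |c|\le\max\textsc{Coeff}(\beta)\cdot p\cdot\mathrm{lcm}\,\textsc{Mod}(\beta)\}$; $\textsc{Mod}_p(\beta)=\{a_1a_2k_1k_2: a_1,a_2\in\textsc{Coeff}(\beta),\ k_1,k_2\in\textsc{Mod}(\beta)\cup\{p\}\}$. A triple $(\beta,\gamma,p)$ satisfies Condition $(\ast)$ if $\textsc{Coeff}(\gamma)\subseteq\textsc{Coeff}_p(\beta)$, $\textsc{Const}(\gamma)\subseteq\textsc{Const}_p(\beta)$ and $\textsc{Mod}(\gamma)\subseteq\textsc{Mod}_p(\beta)$. -}

module Defs where

open import Data.Nat as ℕ using (ℕ; NonZero; _≡ᵇ_; _⊔_)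
open import Data.Nat.LCM using (lcm)
open import Data.Integer as ℤ using (ℤ; +_; -_; ∣_∣; 0ℤ; -1ℤ)
open import Data.Integer.Divisibility using () renaming (_∣_ to _∣ℤ_)
open import Data.List using (List; []; _∷_; _++_; map; foldr; concatMap)
open import Data.List.Membership.Propositional using (_∈_)
open import Data.List.Relation.Unary.All using (All)
open import Data.Product using (_×_; ∃; ∃-syntax; Σ-syntax)
open import Data.Sum using (_⊎_)
open import Data.Bool using (if_then_else_)
open import Relation.Binary.PropositionalEquality using (_≡_; _≢_)
open import Relation.Nullary using (¬_)

data Term : Set where
  var  : ℕ → Term
  con  : ℤ → Term
  _⊕_  : Term → Term → Term
  _⊛_  : ℤ → Term → Term

infixl 6 _⊕_
infixr 7 _⊛_

_⊖_ : Term → Term → Term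
s ⊖ t = s ⊕ (-1ℤ ⊛ t)

data Atom : Set where
  _<ₐ_    : Term → Term → Atom
  _≡[_]_  : Term → (k : ℕ) → .{{NonZero k}} → Term → Atom

data Formula : Set where
  atom  : Atom → Formula
  ¬'_   : Formula → Formula
  _∧'_  : Formula → Formula → Formula
  _∨'_  : Formula → Formula → Formula
  _⇒'_  : Formula → Formula → Formula
  _⇔'_  : Formula → Formula → Formula

Assignment : Set
Assignment = ℕ → ℤ

⟦_⟧ₜ : Term → Assignment → ℤ
⟦ var i ⟧ₜ ρ = ρ i
⟦ con c ⟧ₜ ρ = c
⟦ s ⊕ t ⟧ₜ ρ = ⟦ s ⟧ₜ ρ ℤ.+ ⟦ t ⟧ₜ ρ
⟦ a ⊛ t ⟧ₜ ρ = a ℤ.* ⟦ t ⟧ₜ ρ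

⟦_⟧ₐ : Atom → Assignment → Set
⟦ s <ₐ t ⟧ₐ ρ = ⟦ s ⟧ₜ ρ ℤ.< ⟦ t ⟧ₜ ρ
⟦ s ≡[ k ] t ⟧ₐ ρ = (+ k) ∣ℤ (⟦ s ⟧ₜ ρ ℤ.- ⟦ t ⟧ₜ ρ)

⟦_⟧ : Formula → Assignment → Set
⟦ atom α ⟧ ρ = ⟦ α ⟧ₐ ρ
⟦ ¬' φ ⟧ ρ = ¬ ⟦ φ ⟧ ρ
⟦ φ ∧' ψ ⟧ ρ = ⟦ φ ⟧ ρ × ⟦ ψ ⟧ ρ
⟦ φ ∨' ψ ⟧ ρ = ⟦ φ ⟧ ρ ⊎ ⟦ ψ ⟧ ρ
⟦ φ ⇒' ψ ⟧ ρ = ⟦ φ ⟧ ρ → ⟦ ψ ⟧ ρ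
⟦ φ ⇔' ψ ⟧ ρ = (⟦ φ ⟧ ρ → ⟦ ψ ⟧ ρ) × (⟦ ψ ⟧ ρ → ⟦ φ ⟧ ρ)

_[_↦_] : Assignment → ℕ → ℤ → Assignment
(ρ [ x ↦ n ]) i = if i ≡ᵇ x then n else ρ i

-- Normal forms.  The normal form a₁x_{i₁}+…+aₙx_{iₙ}+c of a term t is
-- described by  coeff t i  (the coefficient of x_i, 0 if x_i does not
-- occur in the normal form) and the constant  cst t.

coeff : Term → ℕ → ℤ
coeff (var j) i = if j ≡ᵇ i then + 1 else 0ℤ
coeff (con c) i = 0ℤ
coeff (s ⊕ t) i = coeff s i ℤ.+ coeff t i
coeff (a ⊛ t) i = a ℤ.* coeff t i

cst : Term → ℤ
cst (var j) = 0ℤ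
cst (con c) = c
cst (s ⊕ t) = cst s ℤ.+ cst t
cst (a ⊛ t) = a ℤ.* cst t

-- variables occurring syntactically in t (a superset of those in the
-- normal form)
vars : Term → List ℕ
vars (var j) = j ∷ []
vars (con c) = []
vars (s ⊕ t) = vars s ++ vars t
vars (a ⊛ t) = vars t

IsNFCoeff : Term → ℤ → Set
IsNFCoeff t a = a ≢ 0ℤ × ∃[ i ] coeff t i ≡ a

XFreeTerm : ℕ → Term → Set
XFreeTerm x t = coeff t x ≡ 0ℤ

XFreeAtom : ℕ → Atom → Set
XFreeAtom x (s <ₐ t) = XFreeTerm x s × XFreeTerm x t
XFreeAtom x (s ≡[ k ] t) = XFreeTerm x s × XFreeTerm x t

IsMulX : ℕ → ℕ → Term → Set
IsMulX x a s = coeff s x ≡ + a × (∀ i → i ≢ x → coeff s i ≡ 0ℤ) × cst s ≡ 0ℤ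

XSepAtom : ℕ → Atom → Set
XSepAtom x (s <ₐ t) =
  (∃[ a ] IsMulX x a s × XFreeTerm x t) ⊎ (∃[ a ] IsMulX x a t × XFreeTerm x s)
XSepAtom x (s ≡[ k ] t) = ∃[ a ] IsMulX x a s × XFreeTerm x t

atoms : Formula → List Atom
atoms (atom α) = α ∷ []
atoms (¬' φ) = atoms φ
atoms (φ ∧' ψ) = atoms φ ++ atoms ψ
atoms (φ ∨' ψ) = atoms φ ++ atoms ψ
atoms (φ ⇒' ψ) = atoms φ ++ atoms ψ
atoms (φ ⇔' ψ) = atoms φ ++ atoms ψ

AllAtoms : (Atom → Set) → Formula → Set
AllAtoms P φ = All P (atoms φ)

ltDiffs′ : Atom → List Term
ltDiffs′ (s <ₐ t) = (s ⊖ t) ∷ []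
ltDiffs′ (s ≡[ k ] t) = []

ltDiffs : Formula → List Term
ltDiffs φ = concatMap ltDiffs′ (atoms φ)

mods′ : Atom → List ℕ
mods′ (s <ₐ t) = []
mods′ (s ≡[ k ] t) = k ∷ []

mods : Formula → List ℕ
mods φ = concatMap mods′ (atoms φ)

Small : ℤ → Set
Small b = b ≡ 0ℤ ⊎ b ≡ + 1 ⊎ b ≡ -1ℤ ⊎ b ≡ + 2 ⊎ b ≡ - (+ 2)

InCoeff : Formula → ℤ → Set
InCoeff φ b = Small b ⊎
  (∃[ t ] t ∈ ltDiffs φ × (IsNFCoeff t b ⊎ IsNFCoeff t (- b)))

InConst : Formula → ℤ → Set
InConst φ b = Small b ⊎
  (∃[ t ] t ∈ ltDiffs φ × (cst t ≡ b ⊎ cst t ≡ - b))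

InMod : Formula → ℕ → Set
InMod φ k = k ≡ 1 ⊎ k ∈ mods φ

-- max Coeff(φ)  (Coeff(φ) is symmetric and contains 2, so this is
-- the maximum of 2 and the absolute values of the coefficients)
maxCoeff : Formula → ℕ
maxCoeff φ = foldr _⊔_ 2
  (concatMap (λ t → map (λ i → ∣ coeff t i ∣) (vars t)) (ltDiffs φ))

lcmMod : Formula → ℕ
lcmMod φ = foldr lcm 1 (mods φ)

InCoeffP : Formula → ℤ → Set
InCoeffP β b = ∃[ a₁ ] ∃[ a₂ ] ∃[ a₃ ] ∃[ a₄ ]
  InCoeff β a₁ × InCoeff β a₂ × InCoeff β a₃ × InCoeff β a₄ ×
  b ≡ a₁ ℤ.* a₂ ℤ.- a₃ ℤ.* a₄

InConstP : Formula → ℕ → ℤ → Set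
InConstP β p b = ∃[ a₁ ] ∃[ a₂ ] ∃[ c₁ ] ∃[ c₂ ] ∃[ c ]
  InCoeff β a₁ × InCoeff β a₂ × InConst β c₁ × InConst β c₂ ×
  ∣ c ∣ ℕ.≤ maxCoeff β ℕ.* p ℕ.* lcmMod β ×
  b ≡ a₁ ℤ.* c₁ ℤ.- a₂ ℤ.* (c₂ ℤ.+ c)

InModP : Formula → ℕ → ℕ → Set
InModP β p k = ∃[ a₁ ] ∃[ a₂ ] ∃[ k₁ ] ∃[ k₂ ]
  InCoeff β a₁ × InCoeff β a₂ ×
  (InMod β k₁ ⊎ k₁ ≡ p) × (InMod β k₂ ⊎ k₂ ≡ p) ×
  + k ≡ a₁ ℤ.* a₂ ℤ.* (+ k₁) ℤ.* (+ k₂)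

Cond∗ : Formula → Formula → ℕ → Set
Cond∗ β γ p =
  (∀ b → InCoeff γ b → InCoeffP β b) ×
  (∀ b → InConst γ b → InConstP β p b) ×
  (∀ k → InMod γ k → InModP β p k)

-- Cooper's quantifier elimination.  Let M be the lcm of the moduli of β.  Far enough below,
-- every bound a x < t or t < a x of β has a fixed truth value and every congruence is
-- M-periodic, so there β is equivalent to β₋∞ with x replaced by some j < M.  Otherwise start
-- from a witness n and move it down by M: while no atom changes its truth value β stays
-- true, and the first bound a x < u or u < a x about to change forces a n = u + c with
-- 0 ≤ c ≤ a M.  Hence ∃x β is equivalent to the disjunction of the β₋∞[j] (j < M) and of the
-- formulas (a ∣ u + c) ∧ a β[a x := u + c], where a β is β with each atom multiplied by a.
-- Every new coefficient, constant and modulus is a product, or difference of products, of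
-- those of β, which is Condition (∗) with p = 1.

module Submission where

open import Defs
open import Data.Nat as ℕ using (ℕ; zero; suc; NonZero; _≡ᵇ_)
import Data.Nat.Properties as ℕP
open import Data.Integer as ℤ using (ℤ; +_; -[1+_]; -_; 0ℤ; 1ℤ; -1ℤ; _+_; _*_; _-_; _<_; _≤_)
import Data.Integer.Properties as ℤP
import Data.Integer.DivMod as ℤDM
open import Data.Nat.LCM using (lcm; m∣lcm[m,n]; n∣lcm[m,n]; gcd*lcm)
open import Data.Nat.GCD using (gcd)
open import Data.Integer.Tactic.RingSolver using (solve-∀)
open import Data.Integer.Divisibility using (_∣_)
import Data.Integer.Divisibility as ℤD
open import Data.Integer.Divisibility.Signed as ℤS using () renaming (_∣_ to _∣ˢ_)
open import Data.List using (List; []; _∷_; foldr; map; concat; concatMap; upTo)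
open import Data.List.Membership.Propositional using (_∈_; mapWith∈; find; lose)
open import Data.List.Membership.Propositional.Properties using (∈-++⁺ˡ; ∈-++⁺ʳ; ∈-map⁺; ∈-map⁻; ∈-concatMap⁺; ∈-concatMap⁻; ∈-upTo⁺; ∈-upTo⁻)
open import Data.List.Relation.Unary.Any as Any using (Any; here; there)
open import Data.List.Relation.Unary.All as All using (All; []; _∷_)
import Data.List.Relation.Unary.All.Properties as Allₚ
import Data.List.Relation.Unary.Any.Properties as Anyₚ
open import Data.Nat.Divisibility as ℕD using (1∣_)
open import Data.Product using (_×_; _,_; proj₁; proj₂; ∃-syntax; Σ-syntax)
open import Data.Product.Function.NonDependent.Propositional using (_×-⇔_)
open import Data.Sum using (_⊎_; inj₁; inj₂; [_,_]′; map₂)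
open import Data.Sum.Function.Propositional using (_⊎-⇔_)
open import Data.Empty using (⊥-elim)
open import Data.Bool using (true; false)
open import Function using (_∘_; _$_; id)
open import Function.Bundles using (_⇔_; mk⇔; Equivalence)
open import Function.Properties.Equivalence using () renaming (trans to ⇔-trans; sym to ⇔-sym)
open import Function.Related.TypeIsomorphisms using (→-cong-⇔; ¬-cong-⇔)
open import Relation.Binary.PropositionalEquality
open import Relation.Nullary using (¬_; Dec; yes; no; recompute; ¬?; _⊎-dec_)
open import Relation.Nullary.Decidable using (decidable-stable)

open Equivalence using (to; from)

-- Terms

update-≡ : ∀ (ρ : Assignment) i n → (ρ [ i ↦ n ]) i ≡ n
update-≡ ρ i n with i ≡ᵇ i | ℕP.≡⇒≡ᵇ i i refl
... | true  | _ = refl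

update-≢ : ∀ (ρ : Assignment) {i j} n → j ≢ i → (ρ [ i ↦ n ]) j ≡ ρ j
update-≢ ρ {i} {j} n j≢i with j ≡ᵇ i | ℕP.≡ᵇ⇒≡ j i
... | false | _   = refl
... | true  | j≡i = ⊥-elim (j≢i (j≡i _))

update-self : ∀ (ρ : Assignment) i j → (ρ [ i ↦ ρ i ]) j ≡ ρ j
update-self ρ i j with j ℕ.≟ i
... | yes refl = update-≡ ρ i (ρ i)
... | no j≢i   = update-≢ ρ (ρ i) j≢i

⟦⟧ₜ-cong : ∀ t {σ τ : Assignment} → (∀ {i} → i ∈ vars t → σ i ≡ τ i) → ⟦ t ⟧ₜ σ ≡ ⟦ t ⟧ₜ τ
⟦⟧ₜ-cong (var j) e = e (here refl)
⟦⟧ₜ-cong (con c) e = refl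
⟦⟧ₜ-cong (s ⊕ t) e = cong₂ _+_ (⟦⟧ₜ-cong s (e ∘ ∈-++⁺ˡ)) (⟦⟧ₜ-cong t (e ∘ ∈-++⁺ʳ (vars s)))
⟦⟧ₜ-cong (a ⊛ t) e = cong (a *_) (⟦⟧ₜ-cong t e)

⟦⟧ₜ-zero : ∀ t → ⟦ t ⟧ₜ (λ _ → 0ℤ) ≡ cst t
⟦⟧ₜ-zero (var j) = refl
⟦⟧ₜ-zero (con c) = refl
⟦⟧ₜ-zero (s ⊕ t) = cong₂ _+_ (⟦⟧ₜ-zero s) (⟦⟧ₜ-zero t)
⟦⟧ₜ-zero (a ⊛ t) = cong (a *_) (⟦⟧ₜ-zero t)

⟦⟧ₜ-update : ∀ t (ρ : Assignment) x n →
             ⟦ t ⟧ₜ (ρ [ x ↦ n ]) ≡ ⟦ t ⟧ₜ (ρ [ x ↦ 0ℤ ]) + coeff t x * n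
⟦⟧ₜ-update (var j) ρ x n with j ≡ᵇ x
... | true  = sym (trans (ℤP.+-identityˡ _) (ℤP.*-identityˡ n))
... | false = sym (trans (cong (_+_ (ρ j)) (ℤP.*-zeroˡ n)) (ℤP.+-identityʳ (ρ j)))
⟦⟧ₜ-update (con c) ρ x n = sym (trans (cong (_+_ c) (ℤP.*-zeroˡ n)) (ℤP.+-identityʳ c))
⟦⟧ₜ-update (s ⊕ t) ρ x n = begin
  ⟦ s ⟧ₜ ρₙ + ⟦ t ⟧ₜ ρₙ
    ≡⟨ cong₂ _+_ (⟦⟧ₜ-update s ρ x n) (⟦⟧ₜ-update t ρ x n) ⟩
  (⟦ s ⟧ₜ ρ₀ + coeff s x * n) + (⟦ t ⟧ₜ ρ₀ + coeff t x * n)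
    ≡⟨ regroup (⟦ s ⟧ₜ ρ₀) (⟦ t ⟧ₜ ρ₀) (coeff s x) (coeff t x) n ⟩
  (⟦ s ⟧ₜ ρ₀ + ⟦ t ⟧ₜ ρ₀) + (coeff s x + coeff t x) * n ∎
  where
  open ≡-Reasoning
  ρₙ = ρ [ x ↦ n ]
  ρ₀ = ρ [ x ↦ 0ℤ ]
  regroup : ∀ S T a b n → (S + a * n) + (T + b * n) ≡ (S + T) + (a + b) * n
  regroup = solve-∀
⟦⟧ₜ-update (a ⊛ t) ρ x n = begin
  a * ⟦ t ⟧ₜ (ρ [ x ↦ n ])                   ≡⟨ cong (a *_) (⟦⟧ₜ-update t ρ x n) ⟩
  a * (⟦ t ⟧ₜ ρ₀ + coeff t x * n)           ≡⟨ distrib a (⟦ t ⟧ₜ ρ₀) (coeff t x) n ⟩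
  a * ⟦ t ⟧ₜ ρ₀ + a * coeff t x * n         ∎
  where
  open ≡-Reasoning
  ρ₀ = ρ [ x ↦ 0ℤ ]
  distrib : ∀ a T c n → a * (T + c * n) ≡ a * T + a * c * n
  distrib = solve-∀

⟦⟧ₜ-split : ∀ t (ρ : Assignment) x → ⟦ t ⟧ₜ ρ ≡ ⟦ t ⟧ₜ (ρ [ x ↦ 0ℤ ]) + coeff t x * ρ x
⟦⟧ₜ-split t ρ x = trans (⟦⟧ₜ-cong t (λ _ → sym (update-self ρ x _))) (⟦⟧ₜ-update t ρ x (ρ x))

⟦⟧ₜ-xfree : ∀ x t → XFreeTerm x t → ∀ (ρ : Assignment) n → ⟦ t ⟧ₜ (ρ [ x ↦ n ]) ≡ ⟦ t ⟧ₜ ρ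
⟦⟧ₜ-xfree x t t-xfree ρ n =
  trans (trans (⟦⟧ₜ-update t ρ x n) (vanish n)) (sym (trans (⟦⟧ₜ-split t ρ x) (vanish (ρ x))))
  where
  vanish : ∀ m → ⟦ t ⟧ₜ (ρ [ x ↦ 0ℤ ]) + coeff t x * m ≡ ⟦ t ⟧ₜ (ρ [ x ↦ 0ℤ ])
  vanish m rewrite t-xfree | ℤP.*-zeroˡ m = ℤP.+-identityʳ _

⟦⟧ₜ≡cst : ∀ t (ρ : Assignment) → (∀ i → coeff t i ≡ 0ℤ ⊎ ρ i ≡ 0ℤ) → ⟦ t ⟧ₜ ρ ≡ cst t
⟦⟧ₜ≡cst t ρ vanish = zeroing (vars t) ρ vanish inj₁
  where
  zeroed : ∀ (ρ : Assignment) i j → (ρ [ i ↦ 0ℤ ]) j ≡ 0ℤ ⊎ (ρ [ i ↦ 0ℤ ]) j ≡ ρ j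
  zeroed ρ i j with j ≡ᵇ i
  ... | true  = inj₁ refl
  ... | false = inj₂ refl

  product≡0 : ∀ {a b} → a ≡ 0ℤ ⊎ b ≡ 0ℤ → a * b ≡ 0ℤ
  product≡0 {b = b} (inj₁ refl) = ℤP.*-zeroˡ b
  product≡0 {a = a} (inj₂ refl) = ℤP.*-zeroʳ a

  zeroing : ∀ L (ρ : Assignment) → (∀ i → coeff t i ≡ 0ℤ ⊎ ρ i ≡ 0ℤ) →
            (∀ {i} → i ∈ vars t → i ∈ L ⊎ ρ i ≡ 0ℤ) → ⟦ t ⟧ₜ ρ ≡ cst t
  zeroing [] ρ _ pending =
    trans (⟦⟧ₜ-cong t λ m → [ (λ ()) , id ]′ (pending m)) (⟦⟧ₜ-zero t)
  zeroing (i ∷ L) ρ vanish pending = begin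
    ⟦ t ⟧ₜ ρ                                  ≡⟨ ⟦⟧ₜ-split t ρ i ⟩
    ⟦ t ⟧ₜ (ρ [ i ↦ 0ℤ ]) + coeff t i * ρ i   ≡⟨ cong (_+_ (⟦ t ⟧ₜ (ρ [ i ↦ 0ℤ ]))) (product≡0 (vanish i)) ⟩
    ⟦ t ⟧ₜ (ρ [ i ↦ 0ℤ ]) + 0ℤ                ≡⟨ ℤP.+-identityʳ _ ⟩
    ⟦ t ⟧ₜ (ρ [ i ↦ 0ℤ ])                     ≡⟨ zeroing L (ρ [ i ↦ 0ℤ ]) vanish′ pending′ ⟩
    cst t                                     ∎
    where
    open ≡-Reasoning
    vanish′ : ∀ j → coeff t j ≡ 0ℤ ⊎ (ρ [ i ↦ 0ℤ ]) j ≡ 0ℤ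
    vanish′ j with zeroed ρ i j
    ... | inj₁ z = inj₂ z
    ... | inj₂ e = map₂ (trans e) (vanish j)
    pending′ : ∀ {j} → j ∈ vars t → j ∈ L ⊎ (ρ [ i ↦ 0ℤ ]) j ≡ 0ℤ
    pending′ m with pending m
    ... | inj₁ (here refl) = inj₂ (update-≡ ρ i 0ℤ)
    ... | inj₁ (there m′)  = inj₁ m′
    ... | inj₂ z = inj₂ ([ id , (λ e → trans e z) ]′ (zeroed ρ i _))

⟦⟧ₜ-mulX : ∀ x {a} s → IsMulX x a s → ∀ (ρ : Assignment) n → ⟦ s ⟧ₜ (ρ [ x ↦ n ]) ≡ + a * n
⟦⟧ₜ-mulX x {a} s (coeff-x , coeff-other , cst≡0) ρ n = begin
  ⟦ s ⟧ₜ (ρ [ x ↦ n ])                       ≡⟨ ⟦⟧ₜ-update s ρ x n ⟩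
  ⟦ s ⟧ₜ (ρ [ x ↦ 0ℤ ]) + coeff s x * n      ≡⟨ cong₂ (λ c a → c + a * n) (trans (⟦⟧ₜ≡cst s _ vanish) cst≡0) coeff-x ⟩
  0ℤ + + a * n                               ≡⟨ ℤP.+-identityˡ _ ⟩
  + a * n                                    ∎
  where
  open ≡-Reasoning
  vanish : ∀ i → coeff s i ≡ 0ℤ ⊎ (ρ [ x ↦ 0ℤ ]) i ≡ 0ℤ
  vanish i with i ℕ.≟ x
  ... | yes refl = inj₂ (update-≡ ρ x 0ℤ)
  ... | no i≢x   = inj₁ (coeff-other i i≢x)

coeff≢0⇒∈vars : ∀ t {i} → coeff t i ≢ 0ℤ → i ∈ vars t
coeff≢0⇒∈vars (var j) {i} c≢0 with j ≡ᵇ i | ℕP.≡ᵇ⇒≡ j i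
... | true  | j≡i = here (sym (j≡i _))
... | false | _   = ⊥-elim (c≢0 refl)
coeff≢0⇒∈vars (con c) c≢0 = ⊥-elim (c≢0 refl)
coeff≢0⇒∈vars (s ⊕ t) {i} c≢0 with coeff s i ℤ.≟ 0ℤ
... | no  s≢0 = ∈-++⁺ˡ (coeff≢0⇒∈vars s s≢0)
... | yes s≡0 = ∈-++⁺ʳ (vars s) (coeff≢0⇒∈vars t λ t≡0 → c≢0 (cong₂ _+_ s≡0 t≡0))
coeff≢0⇒∈vars (a ⊛ t) {i} c≢0 = coeff≢0⇒∈vars t λ t≡0 → c≢0 (trans (cong (a *_) t≡0) (ℤP.*-zeroʳ a))

coeff-⊖ : ∀ s t i → coeff (s ⊖ t) i ≡ coeff s i - coeff t i
coeff-⊖ s t i = cong (_+_ (coeff s i)) (ℤP.-1*i≡-i (coeff t i))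

cst-⊖ : ∀ s t → cst (s ⊖ t) ≡ cst s - cst t
cst-⊖ s t = cong (_+_ (cst s)) (ℤP.-1*i≡-i (cst t))

-- Boolean combinations of atoms

≡⇒⇔ : ∀ {A B : Set} → A ≡ B → A ⇔ B
≡⇒⇔ refl = mk⇔ id id

replaceAtoms : (φ : Formula) → (∀ {α} → α ∈ atoms φ → Formula) → Formula
replaceAtoms (atom α) f = f (here refl)
replaceAtoms (¬' φ)   f = ¬' replaceAtoms φ f
replaceAtoms (φ ∧' ψ) f = replaceAtoms φ (f ∘ ∈-++⁺ˡ) ∧' replaceAtoms ψ (f ∘ ∈-++⁺ʳ (atoms φ))
replaceAtoms (φ ∨' ψ) f = replaceAtoms φ (f ∘ ∈-++⁺ˡ) ∨' replaceAtoms ψ (f ∘ ∈-++⁺ʳ (atoms φ))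
replaceAtoms (φ ⇒' ψ) f = replaceAtoms φ (f ∘ ∈-++⁺ˡ) ⇒' replaceAtoms ψ (f ∘ ∈-++⁺ʳ (atoms φ))
replaceAtoms (φ ⇔' ψ) f = replaceAtoms φ (f ∘ ∈-++⁺ˡ) ⇔' replaceAtoms ψ (f ∘ ∈-++⁺ʳ (atoms φ))

replaceAtoms-atom : ∀ φ → replaceAtoms φ (λ {α} _ → atom α) ≡ φ
replaceAtoms-atom (atom α) = refl
replaceAtoms-atom (¬' φ)   = cong ¬'_ (replaceAtoms-atom φ)
replaceAtoms-atom (φ ∧' ψ) = cong₂ _∧'_ (replaceAtoms-atom φ) (replaceAtoms-atom ψ)
replaceAtoms-atom (φ ∨' ψ) = cong₂ _∨'_ (replaceAtoms-atom φ) (replaceAtoms-atom ψ)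
replaceAtoms-atom (φ ⇒' ψ) = cong₂ _⇒'_ (replaceAtoms-atom φ) (replaceAtoms-atom ψ)
replaceAtoms-atom (φ ⇔' ψ) = cong₂ _⇔'_ (replaceAtoms-atom φ) (replaceAtoms-atom ψ)

⟦replaceAtoms⟧-cong : ∀ φ {f g : ∀ {α} → α ∈ atoms φ → Formula} {ρ σ} →
                      (∀ {α} (m : α ∈ atoms φ) → ⟦ f m ⟧ ρ ⇔ ⟦ g m ⟧ σ) →
                      ⟦ replaceAtoms φ f ⟧ ρ ⇔ ⟦ replaceAtoms φ g ⟧ σ
⟦replaceAtoms⟧-cong (atom α) f⇔g = f⇔g (here refl)
⟦replaceAtoms⟧-cong (¬' φ)   f⇔g = ¬-cong-⇔ (⟦replaceAtoms⟧-cong φ f⇔g)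
⟦replaceAtoms⟧-cong (φ ∧' ψ) f⇔g =
  ⟦replaceAtoms⟧-cong φ (f⇔g ∘ ∈-++⁺ˡ) ×-⇔ ⟦replaceAtoms⟧-cong ψ (f⇔g ∘ ∈-++⁺ʳ (atoms φ))
⟦replaceAtoms⟧-cong (φ ∨' ψ) f⇔g =
  ⟦replaceAtoms⟧-cong φ (f⇔g ∘ ∈-++⁺ˡ) ⊎-⇔ ⟦replaceAtoms⟧-cong ψ (f⇔g ∘ ∈-++⁺ʳ (atoms φ))
⟦replaceAtoms⟧-cong (φ ⇒' ψ) f⇔g =
  →-cong-⇔ (⟦replaceAtoms⟧-cong φ (f⇔g ∘ ∈-++⁺ˡ)) (⟦replaceAtoms⟧-cong ψ (f⇔g ∘ ∈-++⁺ʳ (atoms φ)))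
⟦replaceAtoms⟧-cong (φ ⇔' ψ) f⇔g = →-cong-⇔ l r ×-⇔ →-cong-⇔ r l
  where
  l = ⟦replaceAtoms⟧-cong φ (f⇔g ∘ ∈-++⁺ˡ)
  r = ⟦replaceAtoms⟧-cong ψ (f⇔g ∘ ∈-++⁺ʳ (atoms φ))

⟦replaceAtoms⟧ : ∀ φ {f : ∀ {α} → α ∈ atoms φ → Formula} {ρ σ} →
                 (∀ {α} (m : α ∈ atoms φ) → ⟦ f m ⟧ ρ ⇔ ⟦ α ⟧ₐ σ) →
                 ⟦ replaceAtoms φ f ⟧ ρ ⇔ ⟦ φ ⟧ σ
⟦replaceAtoms⟧ φ {ρ = ρ} {σ} f⇔α =
  subst (λ ψ → ⟦ replaceAtoms φ _ ⟧ ρ ⇔ ⟦ ψ ⟧ σ) (replaceAtoms-atom φ) (⟦replaceAtoms⟧-cong φ f⇔α)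

⟦⟧-cong-atoms : ∀ φ {ρ σ} → (∀ {α} → α ∈ atoms φ → ⟦ α ⟧ₐ ρ ⇔ ⟦ α ⟧ₐ σ) → ⟦ φ ⟧ ρ ⇔ ⟦ φ ⟧ σ
⟦⟧-cong-atoms φ {ρ} {σ} α⇔α =
  subst (λ ψ → ⟦ ψ ⟧ ρ ⇔ ⟦ φ ⟧ σ) (replaceAtoms-atom φ) (⟦replaceAtoms⟧ φ α⇔α)

atoms-replaceAtoms : ∀ {P : Atom → Set} φ {f : ∀ {α} → α ∈ atoms φ → Formula} →
                     (∀ {α} (m : α ∈ atoms φ) → All P (atoms (f m))) →
                     All P (atoms (replaceAtoms φ f))
atoms-replaceAtoms (atom α) P-f = P-f (here refl)
atoms-replaceAtoms (¬' φ)   P-f = atoms-replaceAtoms φ P-f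
atoms-replaceAtoms (φ ∧' ψ) P-f =
  Allₚ.++⁺ (atoms-replaceAtoms φ (P-f ∘ ∈-++⁺ˡ)) (atoms-replaceAtoms ψ (P-f ∘ ∈-++⁺ʳ (atoms φ)))
atoms-replaceAtoms (φ ∨' ψ) P-f =
  Allₚ.++⁺ (atoms-replaceAtoms φ (P-f ∘ ∈-++⁺ˡ)) (atoms-replaceAtoms ψ (P-f ∘ ∈-++⁺ʳ (atoms φ)))
atoms-replaceAtoms (φ ⇒' ψ) P-f =
  Allₚ.++⁺ (atoms-replaceAtoms φ (P-f ∘ ∈-++⁺ˡ)) (atoms-replaceAtoms ψ (P-f ∘ ∈-++⁺ʳ (atoms φ)))
atoms-replaceAtoms (φ ⇔' ψ) P-f =
  Allₚ.++⁺ (atoms-replaceAtoms φ (P-f ∘ ∈-++⁺ˡ)) (atoms-replaceAtoms ψ (P-f ∘ ∈-++⁺ʳ (atoms φ)))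

⊤ₐ : Atom
⊤ₐ = con 0ℤ ≡[ 1 ] con 0ℤ

⊤' ⊥' : Formula
⊤' = atom ⊤ₐ
⊥' = ¬' ⊤'

⊤'-holds : ∀ ρ → ⟦ ⊤' ⟧ ρ
⊤'-holds ρ = 1∣ 0

⋁ : List Formula → Formula
⋁ = foldr _∨'_ ⊥'

⟦⋁⟧ : ∀ φs ρ → ⟦ ⋁ φs ⟧ ρ ⇔ Any (λ φ → ⟦ φ ⟧ ρ) φs
⟦⋁⟧ []       ρ = mk⇔ (λ ⊥'-holds → ⊥-elim (⊥'-holds (⊤'-holds ρ))) λ ()
⟦⋁⟧ (φ ∷ φs) ρ = mk⇔ [ here , there ∘ to (⟦⋁⟧ φs ρ) ]′
                     λ { (here h) → inj₁ h ; (there h) → inj₂ (from (⟦⋁⟧ φs ρ) h) }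

atoms-⋁ : ∀ {P : Atom → Set} φs → P ⊤ₐ → (∀ {φ} → φ ∈ φs → All P (atoms φ)) → All P (atoms (⋁ φs))
atoms-⋁ []       P⊤ P-φs = P⊤ ∷ []
atoms-⋁ (φ ∷ φs) P⊤ P-φs = Allₚ.++⁺ (P-φs (here refl)) (atoms-⋁ φs P⊤ (P-φs ∘ there))

EventuallyBelow : (ℤ → Set) → Set
EventuallyBelow P = ∃[ N ] ∀ n → n ≤ - + N → P n

eventuallyBelow-∀∈ : ∀ {A : Set} (L : List A) (P : ∀ {a} → a ∈ L → ℤ → Set) →
                     (∀ {a} (m : a ∈ L) → EventuallyBelow (P m)) →
                     EventuallyBelow (λ n → ∀ {a} (m : a ∈ L) → P m n)
eventuallyBelow-∀∈ []      P ev = 0 , λ _ _ ()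
eventuallyBelow-∀∈ (a ∷ L) P ev with ev (here refl) | eventuallyBelow-∀∈ L (P ∘ there) (ev ∘ there)
... | N₁ , P-head | N₂ , P-tail = N₁ ℕ.⊔ N₂ , λ where
  n n≤ (here refl) → P-head n (ℤP.≤-trans n≤ (ℤP.neg-mono-≤ (ℤ.+≤+ (ℕP.m≤m⊔n N₁ N₂))))
  n n≤ (there m)   → P-tail n (ℤP.≤-trans n≤ (ℤP.neg-mono-≤ (ℤ.+≤+ (ℕP.m≤n⊔m N₁ N₂)))) m

∀∈-or-counterexample : ∀ {A : Set} (L : List A) {P : ∀ {a} → a ∈ L → Set} →
                       (∀ {a} (m : a ∈ L) → Dec (P m)) →
                       (∀ {a} (m : a ∈ L) → P m) ⊎ ∃[ a ] Σ[ m ∈ a ∈ L ] ¬ P m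
∀∈-or-counterexample []      P? = inj₁ λ ()
∀∈-or-counterexample (a ∷ L) P? with P? (here refl) | ∀∈-or-counterexample L (P? ∘ there)
... | no ¬p | _                   = inj₂ (a , here refl , ¬p)
... | yes p | inj₂ (b , m , ¬p)  = inj₂ (b , there m , ¬p)
... | yes p | inj₁ P-tail        = inj₁ λ { (here refl) → p ; (there m) → P-tail m }

⇔-if-⊎¬ : ∀ {A B : Set} → (A → B) → A ⊎ ¬ B → A ⇔ B
⇔-if-⊎¬ A→B (inj₁ a)  = mk⇔ A→B λ _ → a
⇔-if-⊎¬ A→B (inj₂ ¬b) = mk⇔ A→B λ b → ⊥-elim (¬b b)

i<j⇔suc[i]-j≤0 : ∀ {i j} → i < j ⇔ (1ℤ + i) - j ≤ 0ℤ
i<j⇔suc[i]-j≤0 = mk⇔ (ℤP.i≤j⇒i-j≤0 ∘ ℤP.i<j⇒suc[i]≤j) (ℤP.suc[i]≤j⇒i<j ∘ ℤP.i-j≤0⇒i≤j)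

i<j⇔j-i≰0 : ∀ {i j} → i < j ⇔ (¬ j - i ≤ 0ℤ)
i<j⇔j-i≰0 = mk⇔ (λ i<j j-i≤0 → ℤP.<⇒≱ i<j (ℤP.i-j≤0⇒i≤j j-i≤0)) (λ j-i≰0 → ℤP.≰⇒> (j-i≰0 ∘ ℤP.i≤j⇒i-j≤0))

*-pos-<-⇔ : ∀ a {i j} → + suc a * i < + suc a * j ⇔ i < j
*-pos-<-⇔ a = mk⇔ (ℤP.*-cancelˡ-<-nonNeg (+ suc a)) (ℤP.*-monoˡ-<-pos (+ suc a))

*-pos-∣-⇔ : ∀ a {k i} → + (suc a ℕ.* k) ∣ + suc a * i ⇔ + k ∣ i
*-pos-∣-⇔ a {k} {i} = mk⇔
  (λ d → ℤD.*-cancelˡ-∣ (+ suc a) {+ k} {i} (subst (_∣ + suc a * i) (ℤP.pos-* (suc a) k) d))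
  (λ d → subst (_∣ + suc a * i) (sym (ℤP.pos-* (suc a) k)) (ℤD.*-monoʳ-∣ (+ suc a) {+ k} {i} d))

∣-cong-mod : ∀ {k i j} → k ∣ˢ (i - j) → k ∣ i ⇔ k ∣ j
∣-cong-mod {k} {i} {j} k∣i-j = mk⇔
  (λ k∣i → ℤS.∣⇒∣ᵤ (subst (k ∣ˢ_) (i-[i-j]≡j i j) (ℤS.∣m∣n⇒∣m-n (ℤS.∣ᵤ⇒∣ {k} {i} k∣i) k∣i-j)))
  (λ k∣j → ℤS.∣⇒∣ᵤ (subst (k ∣ˢ_) (j+[i-j]≡i i j) (ℤS.∣m∣n⇒∣m+n (ℤS.∣ᵤ⇒∣ {k} {j} k∣j) k∣i-j)))
  where
  i-[i-j]≡j : ∀ i j → i - (i - j) ≡ j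
  i-[i-j]≡j = solve-∀
  j+[i-j]≡i : ∀ i j → j + (i - j) ≡ i
  j+[i-j]≡i = solve-∀

-∣i∣≤i : ∀ i → - + ℤ.∣ i ∣ ≤ i
-∣i∣≤i (+ n)    = ℤP.neg-≤-pos
-∣i∣≤i -[1+ n ] = ℤP.≤-refl

*-pos-≤-nonPos : ∀ a {n} → n ≤ 0ℤ → + suc a * n ≤ n
*-pos-≤-nonPos a {n} n≤0 = begin
  + suc a * n      ≡⟨ split (+ a) n ⟩
  n + + a * n      ≤⟨ ℤP.+-monoʳ-≤ n (ℤP.≤-trans (ℤP.*-monoˡ-≤-nonNeg (+ a) n≤0) (ℤP.≤-reflexive (ℤP.*-zeroʳ (+ a)))) ⟩
  n + 0ℤ           ≡⟨ ℤP.+-identityʳ n ⟩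
  n                ∎
  where
  open ℤP.≤-Reasoning
  split : ∀ a n → (1ℤ + a) * n ≡ n + a * n
  split = solve-∀

≤foldr-⊔ : ∀ {b} L {v} → v ∈ L → v ℕ.≤ foldr ℕ._⊔_ b L
≤foldr-⊔ (v ∷ L) (here refl) = ℕP.m≤m⊔n v _
≤foldr-⊔ (w ∷ L) (there v∈) = ℕP.≤-trans (≤foldr-⊔ L v∈) (ℕP.m≤n⊔m w _)

∣foldr-lcm : ∀ L {k} → k ∈ L → k ℕD.∣ foldr lcm 1 L
∣foldr-lcm (k ∷ L) (here refl) = m∣lcm[m,n] k _
∣foldr-lcm (j ∷ L) (there m)   = ℕD.∣-trans (∣foldr-lcm L m) (n∣lcm[m,n] j _)

lcm-nonZero : ∀ m n .{{_ : NonZero m}} .{{_ : NonZero n}} → NonZero (lcm m n)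
lcm-nonZero m n = ℕ.≢-nonZero λ lcm≡0 → ℕ.≢-nonZero⁻¹ (m ℕ.* n) {{ℕP.m*n≢0 m n}} (begin
  m ℕ.* n                ≡⟨ gcd*lcm m n ⟨
  gcd m n ℕ.* lcm m n    ≡⟨ cong (gcd m n ℕ.*_) lcm≡0 ⟩
  gcd m n ℕ.* 0          ≡⟨ ℕP.*-zeroʳ (gcd m n) ⟩
  0                      ∎)
  where open ≡-Reasoning

foldr-lcm-nonZero : ∀ L → All NonZero L → NonZero (foldr lcm 1 L)
foldr-lcm-nonZero []      []         = _
foldr-lcm-nonZero (k ∷ L) (k≢0 ∷ L≢0) = lcm-nonZero k (foldr lcm 1 L) {{k≢0}} {{foldr-lcm-nonZero L L≢0}}

j-M[1+N]≤-N : ∀ {j M} .{{_ : NonZero M}} N → j ℕ.< M → + j - + M * + suc N ≤ - + N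
j-M[1+N]≤-N {j} {M} N j<M = begin
  + j - + M * + suc N    ≤⟨ ℤP.+-monoˡ-≤ (- (+ M * + suc N)) (ℤ.+≤+ (ℕP.<⇒≤ j<M)) ⟩
  + M - + M * + suc N    ≡⟨ M-M[1+N] (+ M) (+ N) ⟩
  - (+ M * + N)          ≡⟨ cong -_ (ℤP.pos-* M N) ⟨
  - + (M ℕ.* N)          ≤⟨ ℤP.neg-mono-≤ (ℤ.+≤+ (ℕP.m≤n*m N M)) ⟩
  - + N                  ∎
  where
  open ℤP.≤-Reasoning
  M-M[1+N] : ∀ M N → M - M * (1ℤ + N) ≡ - (M * N)
  M-M[1+N] = solve-∀

-- Condition (∗)

Small-neg : ∀ {b} → Small b → Small (- b)
Small-neg (inj₁ refl)                         = inj₁ refl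
Small-neg (inj₂ (inj₁ refl))                  = inj₂ (inj₂ (inj₁ refl))
Small-neg (inj₂ (inj₂ (inj₁ refl)))           = inj₂ (inj₁ refl)
Small-neg (inj₂ (inj₂ (inj₂ (inj₁ refl))))    = inj₂ (inj₂ (inj₂ (inj₂ refl)))
Small-neg (inj₂ (inj₂ (inj₂ (inj₂ refl))))    = inj₂ (inj₂ (inj₂ (inj₁ refl)))

Cond∗Atom : Formula → ℕ → Atom → Set
Cond∗Atom β p (s <ₐ t)     = (∀ i → InCoeffP β (coeff (s ⊖ t) i)) × InConstP β p (cst (s ⊖ t))
Cond∗Atom β p (s ≡[ k ] t) = InModP β p k

module Condition∗ (β : Formula) where

  InCoeff-neg : ∀ {b} → InCoeff β b → InCoeff β (- b)
  InCoeff-neg (inj₁ small)                     = inj₁ (Small-neg small)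
  InCoeff-neg {b = b} (inj₂ (t , t∈ , inj₁ c)) = inj₂ (t , t∈ , inj₂ (subst (IsNFCoeff t) (sym (ℤP.neg-involutive b)) c))
  InCoeff-neg (inj₂ (t , t∈ , inj₂ c))         = inj₂ (t , t∈ , inj₁ c)

  InConst-neg : ∀ {b} → InConst β b → InConst β (- b)
  InConst-neg (inj₁ small)                     = inj₁ (Small-neg small)
  InConst-neg {b = b} (inj₂ (t , t∈ , inj₁ c)) = inj₂ (t , t∈ , inj₂ (trans c (sym (ℤP.neg-involutive b))))
  InConst-neg (inj₂ (t , t∈ , inj₂ c))         = inj₂ (t , t∈ , inj₁ c)

  1∈Coeff : InCoeff β (+ 1)
  1∈Coeff = inj₁ (inj₂ (inj₁ refl))

  0∈Coeff : InCoeff β 0ℤ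
  0∈Coeff = inj₁ (inj₁ refl)

  0∈Const : InConst β 0ℤ
  0∈Const = inj₁ (inj₁ refl)

  InCoeffP-neg : ∀ {b} → InCoeffP β b → InCoeffP β (- b)
  InCoeffP-neg (a₁ , a₂ , a₃ , a₄ , a₁∈ , a₂∈ , a₃∈ , a₄∈ , refl) =
    a₃ , a₄ , a₁ , a₂ , a₃∈ , a₄∈ , a₁∈ , a₂∈ , swap a₁ a₂ a₃ a₄
    where
    swap : ∀ a₁ a₂ a₃ a₄ → - (a₁ * a₂ - a₃ * a₄) ≡ a₃ * a₄ - a₁ * a₂
    swap = solve-∀

  InConstP-neg : ∀ {p b} → InConstP β p b → InConstP β p (- b)
  InConstP-neg (a₁ , a₂ , c₁ , c₂ , c , a₁∈ , a₂∈ , c₁∈ , c₂∈ , c-bound , refl) =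
    - a₁ , - a₂ , c₁ , c₂ , c , InCoeff-neg a₁∈ , InCoeff-neg a₂∈ , c₁∈ , c₂∈ , c-bound , negate a₁ a₂ c₁ c₂ c
    where
    negate : ∀ a₁ a₂ c₁ c₂ c → - (a₁ * c₁ - a₂ * (c₂ + c)) ≡ (- a₁) * c₁ - (- a₂) * (c₂ + c)
    negate = solve-∀

  InCoeff⇒InCoeffP : ∀ {b} → InCoeff β b → InCoeffP β b
  InCoeff⇒InCoeffP {b} b∈ = b , + 1 , 0ℤ , 0ℤ , b∈ , 1∈Coeff , 0∈Coeff , 0∈Coeff , b≡b*1-0*0 b
    where
    b≡b*1-0*0 : ∀ b → b ≡ b * + 1 - 0ℤ * 0ℤ
    b≡b*1-0*0 = solve-∀

  InConst⇒InConstP : ∀ {p b} → InConst β b → InConstP β p b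
  InConst⇒InConstP {b = b} b∈ = + 1 , 0ℤ , b , 0ℤ , 0ℤ , 1∈Coeff , 0∈Coeff , b∈ , 0∈Const , ℕ.z≤n , b≡1*b-0*0 b
    where
    b≡1*b-0*0 : ∀ b → b ≡ + 1 * b - 0ℤ * (0ℤ + 0ℤ)
    b≡1*b-0*0 = solve-∀

  InModP-scaled : ∀ {p a k k′} → InCoeff β a → InMod β k → + k′ ≡ a * + k → InModP β p k′
  InModP-scaled {a = a} {k} a∈ k∈ k′≡ak = a , + 1 , k , 1 , a∈ , 1∈Coeff , inj₁ k∈ , inj₁ (inj₁ refl) ,
    trans k′≡ak (pad a (+ k))
    where
    pad : ∀ a k → a * k ≡ a * + 1 * k * + 1
    pad = solve-∀

  module _ (γ : Formula) {p} (γ-atoms : All (Cond∗Atom β p) (atoms γ)) where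

    ltDiff-Cond∗ : ∀ {t} → t ∈ ltDiffs γ → (∀ i → InCoeffP β (coeff t i)) × InConstP β p (cst t)
    ltDiff-Cond∗ t∈ with α , α∈ , t∈α ← find (∈-concatMap⁻ ltDiffs′ {xs = atoms γ} t∈) =
      from-atom α (All.lookup γ-atoms α∈) t∈α
      where
      from-atom : ∀ {t} α → Cond∗Atom β p α → t ∈ ltDiffs′ α → (∀ i → InCoeffP β (coeff t i)) × InConstP β p (cst t)
      from-atom (s <ₐ u) cond (here refl) = cond

    mod-Cond∗ : ∀ {k} → k ∈ mods γ → InModP β p k
    mod-Cond∗ k∈ with α , α∈ , k∈α ← find (∈-concatMap⁻ mods′ {xs = atoms γ} k∈) =
      from-atom α (All.lookup γ-atoms α∈) k∈α
      where
      from-atom : ∀ {k} α → Cond∗Atom β p α → k ∈ mods′ α → InModP β p k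
      from-atom (s ≡[ k ] u) cond (here refl) = cond

    Cond∗-from-atoms : Cond∗ β γ p
    Cond∗-from-atoms = coeffs , consts , moduli
      where
      coeffs : ∀ b → InCoeff γ b → InCoeffP β b
      coeffs b (inj₁ small) = InCoeff⇒InCoeffP (inj₁ small)
      coeffs b (inj₂ (t , t∈ , inj₁ (_ , i , refl))) = proj₁ (ltDiff-Cond∗ t∈) i
      coeffs b (inj₂ (t , t∈ , inj₂ (_ , i , c≡-b))) =
        subst (InCoeffP β) (ℤP.neg-involutive b) (InCoeffP-neg (subst (InCoeffP β) c≡-b (proj₁ (ltDiff-Cond∗ t∈) i)))
      consts : ∀ b → InConst γ b → InConstP β p b
      consts b (inj₁ small) = InConst⇒InConstP (inj₁ small)
      consts b (inj₂ (t , t∈ , inj₁ refl)) = proj₂ (ltDiff-Cond∗ t∈)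
      consts b (inj₂ (t , t∈ , inj₂ c≡-b)) =
        subst (InConstP β p) (ℤP.neg-involutive b) (InConstP-neg (subst (InConstP β p) c≡-b (proj₂ (ltDiff-Cond∗ t∈))))
      moduli : ∀ k → InMod γ k → InModP β p k
      moduli k (inj₁ refl) = InModP-scaled 1∈Coeff (inj₁ refl) refl
      moduli k (inj₂ k∈)   = mod-Cond∗ k∈

  module _ {t : Term} (t∈ : t ∈ ltDiffs β) where

    coeff∈Coeff : ∀ i → InCoeff β (coeff t i)
    coeff∈Coeff i with coeff t i ℤ.≟ 0ℤ
    ... | yes c≡0 = subst (InCoeff β) (sym c≡0) 0∈Coeff
    ... | no  c≢0 = inj₂ (t , t∈ , inj₁ (c≢0 , i , refl))

    cst∈Const : InConst β (cst t)
    cst∈Const = inj₂ (t , t∈ , inj₁ refl)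

    ∣coeff∣≤maxCoeff : ∀ i → ℤ.∣ coeff t i ∣ ℕ.≤ maxCoeff β
    ∣coeff∣≤maxCoeff i with coeff t i ℤ.≟ 0ℤ
    ... | yes c≡0 rewrite c≡0 = ℕ.z≤n
    ... | no  c≢0 = ≤foldr-⊔ _ (∈-concatMap⁺ (λ t → map (λ i → ℤ.∣ coeff t i ∣) (vars t))
                                 (Any.map (λ { refl → ∈-map⁺ (λ i → ℤ.∣ coeff t i ∣) (coeff≢0⇒∈vars t c≢0) }) t∈))

-- Atoms separated in x

period : Atom → ℕ
period (s <ₐ t)     = 1
period (s ≡[ k ] t) = k

module Separated (x : ℕ) where

  xfree-⊛ : ∀ a t → XFreeTerm x t → XFreeTerm x (a ⊛ t)
  xfree-⊛ a t t-xfree = trans (cong (a *_) t-xfree) (ℤP.*-zeroʳ a)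

  xfree-⊕con : ∀ u c → XFreeTerm x u → XFreeTerm x (u ⊕ con c)
  xfree-⊕con u c u-xfree = cong (_+ 0ℤ) u-xfree

  Holds : (α : Atom) → XSepAtom x α → Assignment → ℤ → Set
  Holds (s <ₐ t)     (inj₁ (a , _)) ρ n = + a * n < ⟦ t ⟧ₜ ρ
  Holds (s <ₐ t)     (inj₂ (a , _)) ρ n = ⟦ s ⟧ₜ ρ < + a * n
  Holds (s ≡[ k ] t) (a , _)        ρ n = + k ∣ + a * n - ⟦ t ⟧ₜ ρ

  ⟦⟧ₐ⇔Holds : ∀ α q ρ n → ⟦ α ⟧ₐ (ρ [ x ↦ n ]) ⇔ Holds α q ρ n
  ⟦⟧ₐ⇔Holds (s <ₐ t) (inj₁ (a , s≡ax , t-xfree)) ρ n = ≡⇒⇔ $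
    cong₂ _<_ (⟦⟧ₜ-mulX x s s≡ax ρ n) (⟦⟧ₜ-xfree x t t-xfree ρ n)
  ⟦⟧ₐ⇔Holds (s <ₐ t) (inj₂ (a , t≡ax , s-xfree)) ρ n = ≡⇒⇔ $
    cong₂ _<_ (⟦⟧ₜ-xfree x s s-xfree ρ n) (⟦⟧ₜ-mulX x t t≡ax ρ n)
  ⟦⟧ₐ⇔Holds (s ≡[ k ] t) (a , s≡ax , t-xfree) ρ n = ≡⇒⇔ $
    cong (λ d → + k ∣ d) (cong₂ _-_ (⟦⟧ₜ-mulX x s s≡ax ρ n) (⟦⟧ₜ-xfree x t t-xfree ρ n))

  -- Low α q ρ n: at x = n the atom α already has its truth value at x = -∞, that is,
  -- an upper bound a x < t (a > 0) holds and a lower bound t < a x (a > 0) fails.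
  gap : (α : Atom) → XSepAtom x α → Assignment → ℤ → ℤ
  gap (s <ₐ t) (inj₁ (suc a , _)) ρ n = 1ℤ + + suc a * n - ⟦ t ⟧ₜ ρ
  gap (s <ₐ t) (inj₂ (suc a , _)) ρ n = + suc a * n - ⟦ s ⟧ₜ ρ
  gap _        _                  ρ n = 0ℤ

  Low : (α : Atom) → XSepAtom x α → Assignment → ℤ → Set
  Low α q ρ n = gap α q ρ n ≤ 0ℤ

  slope : (α : Atom) → XSepAtom x α → ℕ
  slope (s <ₐ t)     (inj₁ (a , _)) = a
  slope (s <ₐ t)     (inj₂ (a , _)) = a
  slope (s ≡[ k ] t) _              = 0

  gap-shift : ∀ α q ρ n M → gap α q ρ (n - + M) ≡ gap α q ρ n - + (slope α q ℕ.* M)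
  gap-shift (s <ₐ t) (inj₁ (zero , _))  ρ n M = refl
  gap-shift (s <ₐ t) (inj₁ (suc a , _)) ρ n M =
    trans (shift 1ℤ (+ suc a) n (+ M) (⟦ t ⟧ₜ ρ)) (cong (_-_ (1ℤ + + suc a * n - ⟦ t ⟧ₜ ρ)) (sym (ℤP.pos-* (suc a) M)))
    where
    shift : ∀ o a n M t → o + a * (n - M) - t ≡ (o + a * n - t) - a * M
    shift = solve-∀
  gap-shift (s <ₐ t) (inj₂ (zero , _))  ρ n M = refl
  gap-shift (s <ₐ t) (inj₂ (suc a , _)) ρ n M =
    trans (shift (+ suc a) n (+ M) (⟦ s ⟧ₜ ρ)) (cong (_-_ (+ suc a * n - ⟦ s ⟧ₜ ρ)) (sym (ℤP.pos-* (suc a) M)))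
    where
    shift : ∀ a n M s → a * (n - M) - s ≡ (a * n - s) - a * M
    shift = solve-∀
  gap-shift (s ≡[ k ] t) q ρ n M = refl

  Low? : ∀ α q ρ n → Dec (Low α q ρ n)
  Low? α q ρ n = gap α q ρ n ℤP.≤? 0ℤ

  Low-shift : ∀ α q ρ n M → Low α q ρ n → Low α q ρ (n - + M)
  Low-shift α q ρ n M low =
    subst (_≤ 0ℤ) (sym (gap-shift α q ρ n M)) (ℤP.i≤j⇒i-k≤j (+ (slope α q ℕ.* M)) low)

  Low-after-shift⇒gap≤ : ∀ α q ρ n M → Low α q ρ (n - + M) → gap α q ρ n ≤ + (slope α q ℕ.* M)
  Low-after-shift⇒gap≤ α q ρ n M low = ℤP.i-j≤0⇒i≤j (subst (_≤ 0ℤ) (gap-shift α q ρ n M) low)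

  ¬Low⇒slope>0 : ∀ α q ρ n → ¬ Low α q ρ n → 1 ℕ.≤ slope α q
  ¬Low⇒slope>0 (s <ₐ t)     (inj₁ (suc a , _)) ρ n _ = ℕ.s≤s ℕ.z≤n
  ¬Low⇒slope>0 (s <ₐ t)     (inj₂ (suc a , _)) ρ n _ = ℕ.s≤s ℕ.z≤n
  ¬Low⇒slope>0 (s <ₐ t)     (inj₁ (zero , _))  ρ n ¬low = ⊥-elim (¬low ℤP.≤-refl)
  ¬Low⇒slope>0 (s <ₐ t)     (inj₂ (zero , _))  ρ n ¬low = ⊥-elim (¬low ℤP.≤-refl)
  ¬Low⇒slope>0 (s ≡[ k ] t) q                  ρ n ¬low = ⊥-elim (¬low ℤP.≤-refl)

  gap-decreases : ∀ α q ρ n M .{{_ : NonZero M}} F → ¬ Low α q ρ n →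
                  gap α q ρ n ≤ + suc F → gap α q ρ (n - + M) ≤ + F
  gap-decreases α q ρ n M F ¬low g≤1+F rewrite gap-shift α q ρ n M =
    ℤP.≤-trans (ℤP.+-monoʳ-≤ (gap α q ρ n) (ℤP.neg-mono-≤ (ℤ.+≤+ 1≤slope*M))) (ℤP.+-monoˡ-≤ (- + 1) g≤1+F)
    where
    1≤slope*M : 1 ℕ.≤ slope α q ℕ.* M
    1≤slope*M = ℕP.*-mono-≤ (¬Low⇒slope>0 α q ρ n ¬low) (ℕ.>-nonZero⁻¹ M)

  Low-eventually : ∀ α q ρ → EventuallyBelow (Low α q ρ)
  Low-eventually (s <ₐ t) (inj₁ (suc a , _)) ρ = suc ℤ.∣ ⟦ t ⟧ₜ ρ ∣ , λ n n≤ →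
    to i<j⇔suc[i]-j≤0 (begin-strict
      + suc a * n          ≤⟨ *-pos-≤-nonPos a (ℤP.≤-trans n≤ ℤP.neg-≤-pos) ⟩
      n                    ≤⟨ n≤ ⟩
      - + suc ℤ.∣ ⟦ t ⟧ₜ ρ ∣ <⟨ ℤP.neg-mono-< (ℤ.+<+ (ℕP.n<1+n _)) ⟩
      - + ℤ.∣ ⟦ t ⟧ₜ ρ ∣     ≤⟨ -∣i∣≤i (⟦ t ⟧ₜ ρ) ⟩
      ⟦ t ⟧ₜ ρ              ∎)
    where open ℤP.≤-Reasoning
  Low-eventually (s <ₐ t) (inj₂ (suc a , _)) ρ = ℤ.∣ ⟦ s ⟧ₜ ρ ∣ , λ n n≤ →
    ℤP.i≤j⇒i-j≤0 (begin
      + suc a * n          ≤⟨ *-pos-≤-nonPos a (ℤP.≤-trans n≤ ℤP.neg-≤-pos) ⟩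
      n                    ≤⟨ n≤ ⟩
      - + ℤ.∣ ⟦ s ⟧ₜ ρ ∣     ≤⟨ -∣i∣≤i (⟦ s ⟧ₜ ρ) ⟩
      ⟦ s ⟧ₜ ρ              ∎)
    where open ℤP.≤-Reasoning
  Low-eventually (s <ₐ t)     (inj₁ (zero , _)) ρ = 0 , λ _ _ → ℤP.≤-refl
  Low-eventually (s <ₐ t)     (inj₂ (zero , _)) ρ = 0 , λ _ _ → ℤP.≤-refl
  Low-eventually (s ≡[ k ] t) q                 ρ = 0 , λ _ _ → ℤP.≤-refl

  Holds-≡-periodic : ∀ {M} s k .{{_ : NonZero k}} t q ρ n n′ → k ℕD.∣ M → + M ∣ˢ (n - n′) →
                     Holds (s ≡[ k ] t) q ρ n ⇔ Holds (s ≡[ k ] t) q ρ n′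
  Holds-≡-periodic {M} s k t (a , _) ρ n n′ k∣M M∣n-n′ = ∣-cong-mod {+ k} {+ a * n - ⟦ t ⟧ₜ ρ} {+ a * n′ - ⟦ t ⟧ₜ ρ}
      (subst (+ k ∣ˢ_) (sym difference) k∣a[n-n′])
    where
    difference : (+ a * n - ⟦ t ⟧ₜ ρ) - (+ a * n′ - ⟦ t ⟧ₜ ρ) ≡ + a * (n - n′)
    difference = solve-∀′ (+ a) n n′ (⟦ t ⟧ₜ ρ)
      where solve-∀′ : ∀ a n n′ t → (a * n - t) - (a * n′ - t) ≡ a * (n - n′)
            solve-∀′ = solve-∀
    k∣a[n-n′] : + k ∣ˢ + a * (n - n′)
    k∣a[n-n′] = ℤS.∣n⇒∣m*n (+ a) (ℤS.∣-trans (ℤS.∣ᵤ⇒∣ {+ k} {+ M} k∣M) M∣n-n′)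

  0*-irrelevant : ∀ n n′ → + 0 * n ≡ + 0 * n′
  0*-irrelevant n n′ = trans (ℤP.*-zeroˡ n) (sym (ℤP.*-zeroˡ n′))

  Holds-shift : ∀ {M} α q ρ n → period α ℕD.∣ M → Low α q ρ n ⊎ ¬ Low α q ρ (n - + M) →
                Holds α q ρ n ⇔ Holds α q ρ (n - + M)
  Holds-shift {M} (s <ₐ t) (inj₁ (zero , _)) ρ n _ _ = ≡⇒⇔ (cong (_< ⟦ t ⟧ₜ ρ) (0*-irrelevant n (n - + M)))
  Holds-shift {M} (s <ₐ t) (inj₂ (zero , _)) ρ n _ _ = ≡⇒⇔ (cong (⟦ s ⟧ₜ ρ <_) (0*-irrelevant n (n - + M)))
  Holds-shift {M} α@(s <ₐ t) q@(inj₁ (suc a , _)) ρ n _ stable =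
    ⇔-trans i<j⇔suc[i]-j≤0 (⇔-trans (⇔-if-⊎¬ (Low-shift α q ρ n M) stable) (⇔-sym i<j⇔suc[i]-j≤0))
  Holds-shift {M} α@(s <ₐ t) q@(inj₂ (suc a , _)) ρ n _ stable =
    ⇔-trans i<j⇔j-i≰0 (⇔-trans (¬-cong-⇔ (⇔-if-⊎¬ (Low-shift α q ρ n M) stable)) (⇔-sym i<j⇔j-i≰0))
  Holds-shift {M} (s ≡[ k ] t) q ρ n k∣M _ =
    Holds-≡-periodic s k t q ρ n (n - + M) k∣M (ℤS.divides 1ℤ (n-[n-M]≡1*M n (+ M)))
    where
    n-[n-M]≡1*M : ∀ n M → n - (n - M) ≡ 1ℤ * M
    n-[n-M]≡1*M = solve-∀

  minusInfinity : ℕ → (α : Atom) → XSepAtom x α → Formula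
  minusInfinity j (s <ₐ t) (inj₁ (zero , _))  = atom (con 0ℤ <ₐ t)
  minusInfinity j (s <ₐ t) (inj₁ (suc _ , _)) = ⊤'
  minusInfinity j (s <ₐ t) (inj₂ (zero , _))  = atom (s <ₐ con 0ℤ)
  minusInfinity j (s <ₐ t) (inj₂ (suc _ , _)) = ⊥'
  minusInfinity j (_≡[_]_ s k {{k≢0}} t) (a , _) = atom (_≡[_]_ (con (+ a * + j)) k {{k≢0}} t)

  ⟦minusInfinity⟧ : ∀ {M} j α q ρ n → period α ℕD.∣ M → + M ∣ˢ (n - + j) → Low α q ρ n →
                    ⟦ minusInfinity j α q ⟧ ρ ⇔ Holds α q ρ n
  ⟦minusInfinity⟧ j (s <ₐ t) (inj₁ (zero , _)) ρ n _ _ _ =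
    ≡⇒⇔ (cong (_< ⟦ t ⟧ₜ ρ) (sym (ℤP.*-zeroˡ n)))
  ⟦minusInfinity⟧ j (s <ₐ t) (inj₂ (zero , _)) ρ n _ _ _ =
    ≡⇒⇔ (cong (⟦ s ⟧ₜ ρ <_) (sym (ℤP.*-zeroˡ n)))
  ⟦minusInfinity⟧ j (s <ₐ t) (inj₁ (suc a , _)) ρ n _ _ low =
    mk⇔ (λ _ → from i<j⇔suc[i]-j≤0 low) (λ _ → ⊤'-holds ρ)
  ⟦minusInfinity⟧ j (s <ₐ t) (inj₂ (suc a , _)) ρ n _ _ low =
    mk⇔ (λ ⊥'-holds → ⊥-elim (⊥'-holds (⊤'-holds ρ))) (λ holds → ⊥-elim (to i<j⇔j-i≰0 holds low))
  ⟦minusInfinity⟧ j (s ≡[ k ] t) q ρ n k∣M M∣n-j _ =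
    ⇔-sym (Holds-≡-periodic s k t q ρ n (+ j) k∣M M∣n-j)

  b[an]≡a[bn] : ∀ a b n {T} → a * n ≡ T → b * T ≡ a * (b * n)
  b[an]≡a[bn] a b n refl = swap a b n
    where
    swap : ∀ a b n → b * (a * n) ≡ a * (b * n)
    swap = solve-∀

  -- α multiplied by suc a, with (suc a)·x then replaced by T
  substScaled : ℕ → Term → (α : Atom) → XSepAtom x α → Formula
  substScaled a T (s <ₐ t) (inj₁ (b , _)) = atom ((+ b ⊛ T) <ₐ (+ suc a ⊛ t))
  substScaled a T (s <ₐ t) (inj₂ (b , _)) = atom ((+ suc a ⊛ s) <ₐ (+ b ⊛ T))
  substScaled a T (_≡[_]_ s k {{k≢0}} t) (b , _) =
    atom (_≡[_]_ (+ b ⊛ T) (suc a ℕ.* k) {{ℕP.m*n≢0 (suc a) k {{_}} {{k≢0}}}} (+ suc a ⊛ t))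

  ⟦substScaled⟧ : ∀ a T α q ρ n → + suc a * n ≡ ⟦ T ⟧ₜ ρ → ⟦ substScaled a T α q ⟧ ρ ⇔ Holds α q ρ n
  ⟦substScaled⟧ a T (s <ₐ t) (inj₁ (b , _)) ρ n an≡T =
    ⇔-trans (≡⇒⇔ (cong (_< + suc a * ⟦ t ⟧ₜ ρ) (b[an]≡a[bn] (+ suc a) (+ b) n an≡T))) (*-pos-<-⇔ a {+ b * n} {⟦ t ⟧ₜ ρ})
  ⟦substScaled⟧ a T (s <ₐ t) (inj₂ (b , _)) ρ n an≡T =
    ⇔-trans (≡⇒⇔ (cong (+ suc a * ⟦ s ⟧ₜ ρ <_) (b[an]≡a[bn] (+ suc a) (+ b) n an≡T))) (*-pos-<-⇔ a {⟦ s ⟧ₜ ρ} {+ b * n})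
  ⟦substScaled⟧ a T (s ≡[ k ] t) (b , _) ρ n an≡T =
    ⇔-trans (≡⇒⇔ (cong (λ d → + (suc a ℕ.* k) ∣ d) scaled)) (*-pos-∣-⇔ a {k} {+ b * n - ⟦ t ⟧ₜ ρ})
    where
    factor : ∀ a b n t → b * (a * n) - a * t ≡ a * (b * n - t)
    factor = solve-∀
    scaled : + b * ⟦ T ⟧ₜ ρ - + suc a * ⟦ t ⟧ₜ ρ ≡ + suc a * (+ b * n - ⟦ t ⟧ₜ ρ)
    scaled = trans (cong (λ T → + b * T - + suc a * ⟦ t ⟧ₜ ρ) (sym an≡T)) (factor (+ suc a) (+ b) n (⟦ t ⟧ₜ ρ))

-- Elimination of x

module Elimination (x : ℕ) (β : Formula) (β-separated : AllAtoms (XSepAtom x) β) where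

  open Separated x
  open Condition∗ β

  sep : ∀ {α} → α ∈ atoms β → XSepAtom x α
  sep = All.lookup β-separated

  M : ℕ
  M = lcmMod β

  ∈-mods : ∀ {s k t} .{{_ : NonZero k}} → (s ≡[ k ] t) ∈ atoms β → k ∈ mods β
  ∈-mods m = ∈-concatMap⁺ mods′ (Any.map (λ { refl → here refl }) m)

  mods-nonZero : ∀ L → All NonZero (concatMap mods′ L)
  mods-nonZero []                        = []
  mods-nonZero ((s <ₐ t) ∷ L)            = mods-nonZero L
  mods-nonZero (_≡[_]_ s k {{k≢0}} t ∷ L) = recompute (ℕP.nonZero? k) k≢0 ∷ mods-nonZero L

  instance
    M-nonZero : NonZero M
    M-nonZero = foldr-lcm-nonZero (mods β) (mods-nonZero (atoms β))

  period∣M : ∀ {α} → α ∈ atoms β → period α ℕD.∣ M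
  period∣M {s <ₐ t}     _ = ℕD.1∣ M
  period∣M {s ≡[ k ] t} m = ∣foldr-lcm (mods β) (∈-mods m)

  ⟦replaceAtoms-β⟧ : ∀ {f : ∀ {α} → α ∈ atoms β → Formula} ρ n →
                     (∀ {α} (m : α ∈ atoms β) → ⟦ f m ⟧ ρ ⇔ Holds α (sep m) ρ n) →
                     ⟦ replaceAtoms β f ⟧ ρ ⇔ ⟦ β ⟧ (ρ [ x ↦ n ])
  ⟦replaceAtoms-β⟧ ρ n f⇔Holds =
    ⟦replaceAtoms⟧ β λ {α} m → ⇔-trans (f⇔Holds m) (⇔-sym (⟦⟧ₐ⇔Holds α (sep m) ρ n))

  atMinusInfinity : ℕ → Formula
  atMinusInfinity j = replaceAtoms β λ {α} m → minusInfinity j α (sep m)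

  ⟦atMinusInfinity⟧ : ∀ j ρ n → + M ∣ˢ (n - + j) → (∀ {α} (m : α ∈ atoms β) → Low α (sep m) ρ n) →
                      ⟦ atMinusInfinity j ⟧ ρ ⇔ ⟦ β ⟧ (ρ [ x ↦ n ])
  ⟦atMinusInfinity⟧ j ρ n M∣n-j low =
    ⟦replaceAtoms-β⟧ ρ n λ {α} m → ⟦minusInfinity⟧ j α (sep m) ρ n (period∣M m) M∣n-j (low m)

  atMinusInfinity-sound : ∀ j → j ℕ.< M → ∀ ρ → ⟦ atMinusInfinity j ⟧ ρ → ∃[ n ] ⟦ β ⟧ (ρ [ x ↦ n ])
  atMinusInfinity-sound j j<M ρ h
    with N , allLow ← eventuallyBelow-∀∈ (atoms β) (λ m → Low _ (sep m) ρ) (λ m → Low-eventually _ (sep m) ρ)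
    = n , to (⟦atMinusInfinity⟧ j ρ n M∣n-j (allLow n (j-M[1+N]≤-N N j<M))) h
    where
    n = + j - + M * + suc N
    n-j : ∀ j M K → (j - M * K) - j ≡ (- K) * M
    n-j = solve-∀
    M∣n-j : + M ∣ˢ (n - + j)
    M∣n-j = ℤS.divides (- + suc N) (n-j (+ j) (+ M) (+ suc N))

  atMinusInfinity-complete : ∀ ρ n → ⟦ β ⟧ (ρ [ x ↦ n ]) → (∀ {α} (m : α ∈ atoms β) → Low α (sep m) ρ n) →
                             ⟦ atMinusInfinity (n ℤ.%ℕ M) ⟧ ρ
  atMinusInfinity-complete ρ n hβ low = from (⟦atMinusInfinity⟧ (n ℤ.%ℕ M) ρ n M∣n-j low) hβ
    where
    n-j : ∀ j q M → (j + q * M) - j ≡ q * M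
    n-j = solve-∀
    M∣n-j : + M ∣ˢ (n - + (n ℤ.%ℕ M))
    M∣n-j = ℤS.divides (n ℤ./ℕ M)
      (trans (cong (_- + (n ℤ.%ℕ M)) (ℤDM.a≡a%ℕn+[a/ℕn]*n n M)) (n-j (+ (n ℤ.%ℕ M)) (n ℤ./ℕ M) (+ M)))

  -- β at x = (u + c) / suc a, which has to be an integer
  candidate : ℕ → Term → ℕ → Formula
  candidate a u c = atom ((u ⊕ con (+ c)) ≡[ suc a ] con 0ℤ) ∧'
                    replaceAtoms β λ {α} m → substScaled a (u ⊕ con (+ c)) α (sep m)

  candidate-sound : ∀ a u c ρ → ⟦ candidate a u c ⟧ ρ → ∃[ n ] ⟦ β ⟧ (ρ [ x ↦ n ])
  candidate-sound a u c ρ (a∣T , h) with ℤS.divides n T-0≡n*a ← ℤS.∣ᵤ⇒∣ {+ suc a} {⟦ u ⊕ con (+ c) ⟧ₜ ρ - 0ℤ} a∣T =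
    n , to (⟦replaceAtoms-β⟧ ρ n λ {α} m → ⟦substScaled⟧ a T α (sep m) ρ n an≡T) h
    where
    T = u ⊕ con (+ c)
    an≡T : + suc a * n ≡ ⟦ T ⟧ₜ ρ
    an≡T = trans (ℤP.*-comm (+ suc a) n) (trans (sym T-0≡n*a) (ℤP.+-identityʳ (⟦ T ⟧ₜ ρ)))

  candidate-complete : ∀ a u c ρ n → ⟦ β ⟧ (ρ [ x ↦ n ]) → + suc a * n ≡ ⟦ u ⟧ₜ ρ + + c →
                       ⟦ candidate a u c ⟧ ρ
  candidate-complete a u c ρ n hβ an≡T =
    ℤS.∣⇒∣ᵤ (ℤS.divides n (trans (ℤP.+-identityʳ _) (trans (sym an≡T) (ℤP.*-comm (+ suc a) n)))) ,
    from (⟦replaceAtoms-β⟧ ρ n λ {α} m → ⟦substScaled⟧ a (u ⊕ con (+ c)) α (sep m) ρ n an≡T) hβ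

  candidatesFor : (α : Atom) → XSepAtom x α → List Formula
  candidatesFor (s <ₐ t) (inj₁ (suc a , _)) = map (candidate a t) (upTo (suc (suc a ℕ.* M)))
  candidatesFor (s <ₐ t) (inj₂ (suc a , _)) = map (candidate a s) (upTo (suc (suc a ℕ.* M)))
  candidatesFor _        _                  = []

  candidates : List Formula
  candidates = concat (mapWith∈ (atoms β) λ {α} m → candidatesFor α (sep m))

  Any-candidates⁺ : ∀ {P : Formula → Set} {α} (m : α ∈ atoms β) → Any P (candidatesFor α (sep m)) → Any P candidates
  Any-candidates⁺ {α = α} m h = Anyₚ.concat⁺ (Anyₚ.mapWith∈⁺ _ (α , m , h))

  Any-candidates⁻ : ∀ {P : Formula → Set} → Any P candidates → ∃[ α ] Σ[ m ∈ α ∈ atoms β ] Any P (candidatesFor α (sep m))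
  Any-candidates⁻ h = Anyₚ.mapWith∈⁻ (atoms β) _ (Anyₚ.concat⁻ _ h)

  candidatesFor-sound : ∀ α q ρ → Any (λ φ → ⟦ φ ⟧ ρ) (candidatesFor α q) → ∃[ n ] ⟦ β ⟧ (ρ [ x ↦ n ])
  candidatesFor-sound (s <ₐ t) (inj₁ (suc a , _)) ρ h with c , _ , hc ← find (Anyₚ.map⁻ h) = candidate-sound a t c ρ hc
  candidatesFor-sound (s <ₐ t) (inj₂ (suc a , _)) ρ h with c , _ , hc ← find (Anyₚ.map⁻ h) = candidate-sound a s c ρ hc

  candidate-in-range : ∀ a u ρ n → ⟦ β ⟧ (ρ [ x ↦ n ]) →
                       0ℤ ≤ + suc a * n - ⟦ u ⟧ₜ ρ → + suc a * n - ⟦ u ⟧ₜ ρ ≤ + (suc a ℕ.* M) →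
                       Any (λ φ → ⟦ φ ⟧ ρ) (map (candidate a u) (upTo (suc (suc a ℕ.* M))))
  candidate-in-range a u ρ n hβ 0≤v v≤aM =
    Anyₚ.map⁺ (lose (∈-upTo⁺ (ℕ.s≤s c≤aM)) (candidate-complete a u c ρ n hβ an≡u+c))
    where
    c = ℤ.∣ + suc a * n - ⟦ u ⟧ₜ ρ ∣
    c≡v : + c ≡ + suc a * n - ⟦ u ⟧ₜ ρ
    c≡v = ℤP.0≤i⇒+∣i∣≡i 0≤v
    c≤aM : c ℕ.≤ suc a ℕ.* M
    c≤aM = ℤP.drop‿+≤+ (subst (_≤ _) (sym c≡v) v≤aM)
    i≡j+[i-j] : ∀ i j → i ≡ j + (i - j)
    i≡j+[i-j] = solve-∀
    an≡u+c : + suc a * n ≡ ⟦ u ⟧ₜ ρ + + c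
    an≡u+c = trans (i≡j+[i-j] (+ suc a * n) (⟦ u ⟧ₜ ρ)) (cong (_+_ (⟦ u ⟧ₜ ρ)) (sym c≡v))

  candidatesFor-complete : ∀ α q ρ n → ⟦ β ⟧ (ρ [ x ↦ n ]) → ¬ Low α q ρ n → Low α q ρ (n - + M) →
                           Any (λ φ → ⟦ φ ⟧ ρ) (candidatesFor α q)
  candidatesFor-complete α@(s <ₐ t) q@(inj₁ (suc a , _)) ρ n hβ ¬low low′ =
    candidate-in-range a t ρ n hβ 0≤v (ℤP.≤-trans (ℤP.i≤suc[i] v) (subst (_≤ _) gap≡1+v (Low-after-shift⇒gap≤ α q ρ n M low′)))
    where
    v = + suc a * n - ⟦ t ⟧ₜ ρ
    gap≡1+v : gap α q ρ n ≡ 1ℤ + v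
    gap≡1+v = ℤP.+-assoc 1ℤ (+ suc a * n) (- ⟦ t ⟧ₜ ρ)
    0≤v : 0ℤ ≤ v
    0≤v = ℤP.≮⇒≥ λ v<0 → ¬low (subst (_≤ 0ℤ) (sym gap≡1+v) (ℤP.i<j⇒suc[i]≤j v<0))
  candidatesFor-complete α@(s <ₐ t) q@(inj₂ (suc a , _)) ρ n hβ ¬low low′ =
    candidate-in-range a s ρ n hβ (ℤP.<⇒≤ (ℤP.≰⇒> ¬low)) (Low-after-shift⇒gap≤ α q ρ n M low′)
  candidatesFor-complete (s <ₐ t)     (inj₁ (zero , _)) ρ n hβ ¬low _ = ⊥-elim (¬low ℤP.≤-refl)
  candidatesFor-complete (s <ₐ t)     (inj₂ (zero , _)) ρ n hβ ¬low _ = ⊥-elim (¬low ℤP.≤-refl)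
  candidatesFor-complete (s ≡[ k ] t) q                 ρ n hβ ¬low _ = ⊥-elim (¬low ℤP.≤-refl)

  Stable : Assignment → ℤ → Set
  Stable ρ n = ∀ {α} (m : α ∈ atoms β) → Low α (sep m) ρ n ⊎ ¬ Low α (sep m) ρ (n - + M)

  β-shift : ∀ ρ n → Stable ρ n → ⟦ β ⟧ (ρ [ x ↦ n ]) → ⟦ β ⟧ (ρ [ x ↦ n - + M ])
  β-shift ρ n stable = to (⟦⟧-cong-atoms β λ {α} m →
    ⇔-trans (⟦⟧ₐ⇔Holds α (sep m) ρ n)
      (⇔-trans (Holds-shift α (sep m) ρ n (period∣M m) (stable m)) (⇔-sym (⟦⟧ₐ⇔Holds α (sep m) ρ (n - + M)))))

  -- Shift x down by M while no atom changes its truth value; the gap of α₀ drops each time,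
  -- so some atom must eventually switch, and the last point before the switch is a candidate.
  descend : ∀ F ρ n → ⟦ β ⟧ (ρ [ x ↦ n ]) → ∀ {α₀} (m₀ : α₀ ∈ atoms β) → ¬ Low α₀ (sep m₀) ρ n →
            gap α₀ (sep m₀) ρ n ≤ + F → Any (λ φ → ⟦ φ ⟧ ρ) candidates
  descend zero    ρ n hβ m₀ ¬low g≤0 = ⊥-elim (¬low g≤0)
  descend (suc F) ρ n hβ m₀ ¬low g≤1+F
    with ∀∈-or-counterexample (atoms β) (λ m → Low? _ (sep m) ρ n ⊎-dec ¬? (Low? _ (sep m) ρ (n - + M)))
  ... | inj₂ (α , m , unstable) =
    Any-candidates⁺ m (candidatesFor-complete α (sep m) ρ n hβ (unstable ∘ inj₁)
                         (decidable-stable (Low? α (sep m) ρ (n - + M)) (unstable ∘ inj₂)))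
  ... | inj₁ stable =
    descend F ρ (n - + M) (β-shift ρ n stable hβ) m₀ ([ (λ low → ⊥-elim (¬low low)) , id ]′ (stable m₀))
            (gap-decreases _ (sep m₀) ρ n M F ¬low g≤1+F)

  γ : Formula
  γ = ⋁ (map atMinusInfinity (upTo M)) ∨' ⋁ candidates

  γ-sound : ∀ ρ → ⟦ γ ⟧ ρ → ∃[ n ] ⟦ β ⟧ (ρ [ x ↦ n ])
  γ-sound ρ (inj₁ h) with j , j∈ , hj ← find (Anyₚ.map⁻ (to (⟦⋁⟧ _ ρ) h)) =
    atMinusInfinity-sound j (∈-upTo⁻ j∈) ρ hj
  γ-sound ρ (inj₂ h) with α , m , hα ← Any-candidates⁻ (to (⟦⋁⟧ candidates ρ) h) =
    candidatesFor-sound α (sep m) ρ hα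

  γ-complete : ∀ ρ n → ⟦ β ⟧ (ρ [ x ↦ n ]) → ⟦ γ ⟧ ρ
  γ-complete ρ n hβ with ∀∈-or-counterexample (atoms β) (λ m → Low? _ (sep m) ρ n)
  ... | inj₁ allLow = inj₁ (from (⟦⋁⟧ _ ρ)
    (Anyₚ.map⁺ (lose (∈-upTo⁺ (ℤDM.n%ℕd<d n M)) (atMinusInfinity-complete ρ n hβ allLow))))
  ... | inj₂ (α , m , ¬low) = inj₂ (from (⟦⋁⟧ candidates ρ)
    (descend ℤ.∣ gap α (sep m) ρ n ∣ ρ n hβ m ¬low (ℤP.≤-reflexive (sym (ℤP.0≤i⇒+∣i∣≡i (ℤP.<⇒≤ (ℤP.≰⇒> ¬low)))))))

  ∈-ltDiffs : ∀ {s t} → (s <ₐ t) ∈ atoms β → (s ⊖ t) ∈ ltDiffs β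
  ∈-ltDiffs m = ∈-concatMap⁺ ltDiffs′ (Any.map (λ { refl → here refl }) m)

  record Bound (b : ℕ) (u : Term) : Set where
    field
      u-xfree : XFreeTerm x u
      u-coeff : ∀ i → InCoeff β (coeff u i)
      u-cst   : InConst β (cst u)
      b-coeff : InCoeff β (+ b)
      b≤max   : b ℕ.≤ maxCoeff β

  bound-upper : ∀ {s t b} → (s <ₐ t) ∈ atoms β → IsMulX x b s → XFreeTerm x t → Bound b t
  bound-upper {s} {t} {b} m (s-x , s-other , s-cst) t-xfree = record
    { u-xfree = t-xfree
    ; u-coeff = u-coeff
    ; u-cst   = subst (InConst β) (neg-of (trans (cst-⊖ s t) (cong (_- cst t) s-cst))) (InConst-neg (cst∈Const d∈))
    ; b-coeff = subst (InCoeff β) d-x (coeff∈Coeff d∈ x)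
    ; b≤max   = subst (ℕ._≤ maxCoeff β) (cong ℤ.∣_∣ d-x) (∣coeff∣≤maxCoeff d∈ x)
    }
    where
    d∈ = ∈-ltDiffs m
    neg-of : ∀ {c d} → c ≡ 0ℤ - d → - c ≡ d
    neg-of {d = d} refl = trans (cong -_ (ℤP.+-identityˡ (- d))) (ℤP.neg-involutive d)
    d-x : coeff (s ⊖ t) x ≡ + b
    d-x = trans (coeff-⊖ s t x) (trans (cong₂ _-_ s-x t-xfree) (ℤP.+-identityʳ (+ b)))
    u-coeff : ∀ i → InCoeff β (coeff t i)
    u-coeff i with i ℕ.≟ x
    ... | yes refl = subst (InCoeff β) (sym t-xfree) 0∈Coeff
    ... | no  i≢x  = subst (InCoeff β) (neg-of (trans (coeff-⊖ s t i) (cong (_- coeff t i) (s-other i i≢x))))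
                           (InCoeff-neg (coeff∈Coeff d∈ i))

  bound-lower : ∀ {s t b} → (s <ₐ t) ∈ atoms β → IsMulX x b t → XFreeTerm x s → Bound b s
  bound-lower {s} {t} {b} m (t-x , t-other , t-cst) s-xfree = record
    { u-xfree = s-xfree
    ; u-coeff = u-coeff
    ; u-cst   = subst (InConst β) (trans (cst-⊖ s t) (trans (cong (_-_ (cst s)) t-cst) (ℤP.+-identityʳ (cst s))))
                      (cst∈Const d∈)
    ; b-coeff = subst (InCoeff β) (trans (cong -_ d-x) (ℤP.neg-involutive (+ b))) (InCoeff-neg (coeff∈Coeff d∈ x))
    ; b≤max   = subst (ℕ._≤ maxCoeff β) (trans (cong ℤ.∣_∣ d-x) (ℤP.∣-i∣≡∣i∣ (+ b))) (∣coeff∣≤maxCoeff d∈ x)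
    }
    where
    d∈ = ∈-ltDiffs m
    d-x : coeff (s ⊖ t) x ≡ - + b
    d-x = trans (coeff-⊖ s t x) (trans (cong₂ _-_ s-xfree t-x) (ℤP.+-identityˡ (- + b)))
    u-coeff : ∀ i → InCoeff β (coeff s i)
    u-coeff i with i ℕ.≟ x
    ... | yes refl = subst (InCoeff β) (sym s-xfree) 0∈Coeff
    ... | no  i≢x  = subst (InCoeff β) (trans (coeff-⊖ s t i) (trans (cong (_-_ (coeff s i)) (t-other i i≢x)) (ℤP.+-identityʳ _)))
                           (coeff∈Coeff d∈ i)

  Good : Atom → Set
  Good α = XFreeAtom x α × Cond∗Atom β 1 α

  ⊤ₐ-good : Good ⊤ₐ
  ⊤ₐ-good = (refl , refl) , InModP-scaled 1∈Coeff (inj₁ refl) refl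

  minusInfinity-good : ∀ j {α} → α ∈ atoms β → (q : XSepAtom x α) → All Good (atoms (minusInfinity j α q))
  minusInfinity-good j {s <ₐ t} m (inj₁ (zero , s≡0x , t-xfree)) =
    ((refl , t-xfree) , (λ i → InCoeff⇒InCoeffP (subst (InCoeff β) (0-c (coeff t i)) (InCoeff-neg (u-coeff i)))) ,
                        InConst⇒InConstP (subst (InConst β) (0-c (cst t)) (InConst-neg u-cst))) ∷ []
    where
    open Bound (bound-upper m s≡0x t-xfree)
    0-c : ∀ c → - c ≡ 0ℤ + -1ℤ * c
    0-c c = sym (trans (ℤP.+-identityˡ _) (ℤP.-1*i≡-i c))
  minusInfinity-good j {s <ₐ t} m (inj₂ (zero , t≡0x , s-xfree)) =
    ((s-xfree , refl) , (λ i → InCoeff⇒InCoeffP (subst (InCoeff β) (c-0 (coeff s i)) (u-coeff i))) ,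
                        InConst⇒InConstP (subst (InConst β) (c-0 (cst s)) u-cst)) ∷ []
    where
    open Bound (bound-lower m t≡0x s-xfree)
    c-0 : ∀ c → c ≡ c + -1ℤ * 0ℤ
    c-0 c = sym (ℤP.+-identityʳ c)
  minusInfinity-good j {s <ₐ t} m (inj₁ (suc _ , _)) = ⊤ₐ-good ∷ []
  minusInfinity-good j {s <ₐ t} m (inj₂ (suc _ , _)) = ⊤ₐ-good ∷ []
  minusInfinity-good j {s ≡[ k ] t} m (a , _ , t-xfree) =
    ((refl , t-xfree) , InModP-scaled 1∈Coeff (inj₂ (∈-mods m)) (sym (ℤP.*-identityˡ (+ k)))) ∷ []

  offset-bound : ∀ {a c} → a ℕ.≤ maxCoeff β → c ℕ.≤ a ℕ.* M → c ℕ.≤ maxCoeff β ℕ.* 1 ℕ.* lcmMod β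
  offset-bound {a} {c} a≤max c≤aM = begin
    c                          ≤⟨ c≤aM ⟩
    a ℕ.* M                    ≤⟨ ℕP.*-monoˡ-≤ M a≤max ⟩
    maxCoeff β ℕ.* M           ≡⟨ cong (ℕ._* M) (ℕP.*-identityʳ (maxCoeff β)) ⟨
    maxCoeff β ℕ.* 1 ℕ.* M     ∎
    where open ℕP.≤-Reasoning

  substScaled-good : ∀ {a u c} → Bound (suc a) u → c ℕ.≤ suc a ℕ.* M → ∀ {α} → α ∈ atoms β →
                     (q : XSepAtom x α) → All Good (atoms (substScaled a (u ⊕ con (+ c)) α q))
  substScaled-good {a} {u} {c} bu c≤aM {s <ₐ t} m (inj₁ (b , s≡bx , t-xfree)) =
    ((T-xfree , xfree-⊛ (+ suc a) t t-xfree) ,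
     (λ i → + b , coeff u i , + suc a , coeff t i , b-coeff , U.u-coeff i , U.b-coeff , u-coeff i ,
            coeff-eq (+ b) (coeff u i) (+ suc a) (coeff t i)) ,
     (+ suc a , + b , - cst t , - cst u , - + c , U.b-coeff , b-coeff , InConst-neg u-cst , InConst-neg U.u-cst ,
      subst (ℕ._≤ _) (sym (ℤP.∣-i∣≡∣i∣ (+ c))) (offset-bound U.b≤max c≤aM) ,
      cst-eq (+ b) (cst u) (+ c) (+ suc a) (cst t))) ∷ []
    where
    module U = Bound bu
    open Bound (bound-upper m s≡bx t-xfree)
    T-xfree = xfree-⊛ (+ b) (u ⊕ con (+ c)) (xfree-⊕con u (+ c) U.u-xfree)
    coeff-eq : ∀ b U a V → b * (U + 0ℤ) + -1ℤ * (a * V) ≡ b * U - a * V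
    coeff-eq = solve-∀
    cst-eq : ∀ b U c a V → b * (U + c) + -1ℤ * (a * V) ≡ a * (- V) - b * (- U + - c)
    cst-eq = solve-∀
  substScaled-good {a} {u} {c} bu c≤aM {s <ₐ t} m (inj₂ (b , t≡bx , s-xfree)) =
    ((xfree-⊛ (+ suc a) s s-xfree , T-xfree) ,
     (λ i → + suc a , coeff s i , + b , coeff u i , U.b-coeff , u-coeff i , b-coeff , U.u-coeff i ,
            coeff-eq (+ b) (coeff u i) (+ suc a) (coeff s i)) ,
     (+ suc a , + b , cst s , cst u , + c , U.b-coeff , b-coeff , u-cst , U.u-cst ,
      offset-bound U.b≤max c≤aM , cst-eq (+ b) (cst u) (+ c) (+ suc a) (cst s))) ∷ []
    where
    module U = Bound bu
    open Bound (bound-lower m t≡bx s-xfree)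
    T-xfree = xfree-⊛ (+ b) (u ⊕ con (+ c)) (xfree-⊕con u (+ c) U.u-xfree)
    coeff-eq : ∀ b U a V → a * V + -1ℤ * (b * (U + 0ℤ)) ≡ a * V - b * U
    coeff-eq = solve-∀
    cst-eq : ∀ b U c a V → a * V + -1ℤ * (b * (U + c)) ≡ a * V - b * (U + c)
    cst-eq = solve-∀
  substScaled-good {a} {u} {c} bu c≤aM {s ≡[ k ] t} m (b , _ , t-xfree) =
    ((T-xfree , xfree-⊛ (+ suc a) t t-xfree) ,
     InModP-scaled (Bound.b-coeff bu) (inj₂ (∈-mods m)) (ℤP.pos-* (suc a) k)) ∷ []
    where
    T-xfree = xfree-⊛ (+ b) (u ⊕ con (+ c)) (xfree-⊕con u (+ c) (Bound.u-xfree bu))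

  candidate-good : ∀ {a u c} → Bound (suc a) u → c ℕ.≤ suc a ℕ.* M → All Good (atoms (candidate a u c))
  candidate-good {a} {u} {c} bu c≤aM =
    ((xfree-⊕con u (+ c) u-xfree , refl) , InModP-scaled b-coeff (inj₁ refl) (sym (ℤP.*-identityʳ (+ suc a)))) ∷
    atoms-replaceAtoms β λ m → substScaled-good bu c≤aM m (sep m)
    where open Bound bu

  candidatesFor-good : ∀ {α} → α ∈ atoms β → (q : XSepAtom x α) → ∀ {φ} → φ ∈ candidatesFor α q → All Good (atoms φ)
  candidatesFor-good {s <ₐ t} m (inj₁ (suc a , s≡ax , t-xfree)) φ∈ with c , c∈ , refl ← ∈-map⁻ (candidate a t) φ∈ =
    candidate-good (bound-upper m s≡ax t-xfree) (ℕP.≤-pred (∈-upTo⁻ c∈))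
  candidatesFor-good {s <ₐ t} m (inj₂ (suc a , t≡ax , s-xfree)) φ∈ with c , c∈ , refl ← ∈-map⁻ (candidate a s) φ∈ =
    candidate-good (bound-lower m t≡ax s-xfree) (ℕP.≤-pred (∈-upTo⁻ c∈))

  γ-good : All Good (atoms γ)
  γ-good = Allₚ.++⁺ (atoms-⋁ _ ⊤ₐ-good minusInfinity-disjuncts-good) (atoms-⋁ candidates ⊤ₐ-good candidates-good)
    where
    minusInfinity-disjuncts-good : ∀ {φ} → φ ∈ map atMinusInfinity (upTo M) → All Good (atoms φ)
    minusInfinity-disjuncts-good φ∈ with j , _ , refl ← ∈-map⁻ atMinusInfinity φ∈ =
      atoms-replaceAtoms β λ m → minusInfinity-good j m (sep m)
    candidates-good : ∀ {φ} → φ ∈ candidates → All Good (atoms φ)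
    candidates-good φ∈ with α , m , φ∈α ← Any-candidates⁻ φ∈ = candidatesFor-good m (sep m) φ∈α

lemma4p2 : (x : ℕ) (β : Formula) → AllAtoms (XSepAtom x) β →
    Σ[ γ ∈ Formula ] AllAtoms (XFreeAtom x) γ × Cond∗ β γ 1 ×
      (∀ (ρ : Assignment) →
        ((∃[ n ] ⟦ β ⟧ (ρ [ x ↦ n ])) → ⟦ γ ⟧ ρ) ×
        (⟦ γ ⟧ ρ → ∃[ n ] ⟦ β ⟧ (ρ [ x ↦ n ])))
lemma4p2 x β β-separated =
  γ , All.map proj₁ γ-good , Condition∗.Cond∗-from-atoms β γ (All.map proj₂ γ-good) ,
  λ ρ → (λ (n , hβ) → γ-complete ρ n hβ) , γ-sound ρ
  where open Elimination x β β-separated
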